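{- Let $r,n\ge1$ be relatively prime integers and $c,d\in\mathbb{Z}$, and put $\mathscr{d}_1=\gcd(c-d,n)$, $\mathscr{d}_2=\gcd(c+(r-1)d,n)$. Then $n^r/|\Lambda_{fin}|=n^r/(\mathscr{d}_1^{\,r-1}\mathscr{d}_2)$.
   Context: $B_{c,d}$ is the $r\times r$ matrix with diagonal entries $c$ and off-diagonal entries $d$, and $\Lambda_{fin}=\{\boldsymbol{x}\in(\mathbb{Z}/n\mathbb{Z})^r:B_{c,d}\boldsymbol{x}\equiv\boldsymbol{0}\pmod n\}$. The quantity $n^r/|\Lambda_{fin}|$ is the dimension of the space $\mathfrak{W}$ of Whittaker functions on a principal series representation of the $n$-fold metaplectic cover of $GL_r(F)$ attached to the bilinear form with matrix $B_{c,d}$. -}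

module Defs where

open import Data.Nat using (ℕ; zero; suc)
open import Data.Nat.Divisibility using (_∣_; _∣?_)
open import Data.Integer as ℤ using (ℤ; +_; ∣_∣)
open import Data.Fin using (Fin; toℕ; _≟_)
open import Data.Vec using (Vec; []; _∷_; lookup)
open import Data.List using (List; []; _∷_; map; concatMap; allFin; sum; length; filter; foldr)
open import Data.List.Relation.Unary.All using (All)
open import Data.List.Relation.Unary.All using (all?)
open import Relation.Nullary using (does)
open import Data.Bool using (if_then_else_)

B : (c d : ℤ) → {r : ℕ} → Fin r → Fin r → ℤ
B c d i j = if does (i ≟ j) then c else d

Σℤ : {r : ℕ} → (Fin r → ℤ) → ℤ
Σℤ {r} f = foldr ℤ._+_ (+ 0) (map f (allFin r))

-- All elements of (ℤ/nℤ)^r, with ℤ/nℤ represented by Fin n (residues 0,…,n-1).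
allVecs : (n r : ℕ) → List (Vec (Fin n) r)
allVecs n zero    = [] ∷ []
allVecs n (suc r) = concatMap (λ a → map (a ∷_) (allVecs n r)) (allFin n)

Bx : (c d : ℤ) {n r : ℕ} → Vec (Fin n) r → Fin r → ℤ
Bx c d x i = Σℤ (λ j → B c d i j ℤ.* (+ toℕ (lookup x j)))

InΛfin : (c d : ℤ) (n r : ℕ) → Vec (Fin n) r → Set
InΛfin c d n r x = All (λ i → n ∣ ∣ Bx c d x i ∣) (allFin r)

cardΛfin : (c d : ℤ) (n r : ℕ) → ℕ
cardΛfin c d n r =
  length (filter (λ x → all? (λ i → n ∣? ∣ Bx c d x i ∣) (allFin r)) (allVecs n r))

module Submission where

-- Substituting x = (t, t + z₁, …, t + zₘ) (mod n) is a bijection of (ℤ/n)^r with ℤ/n × (ℤ/n)^m,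
-- where r = m + 1. Row i of B_{c,d} x is (c − d) xᵢ + d Σx, so subtracting row 0 and summing all
-- rows shows that x ∈ Λ_fin forces (c − d) zⱼ ≡ 0 for all j and b Σx ≡ 0, where b = c + (r − 1) d
-- and Σx = r t + Σz. Conversely these give r ((c − d) t + d Σx) ≡ b Σx − (c − d) Σz ≡ 0, and r is a
-- unit mod n, so every row vanishes. For fixed z the map t ↦ r t + Σz permutes ℤ/n, and the number
-- of u ∈ ℤ/n with A u ≡ 0 is gcd(A, n); hence |Λ_fin| = gcd(c − d, n)^m · gcd(b, n).

open import Data.Fin.Base using (Fin; zero; suc; toℕ)
open import Data.Fin.Permutation using (Permutation; _⟨$⟩ʳ_)
open import Data.Integer.Base using (ℤ)
open import Data.List.Base using (List; []; _∷_; map; length; filter; tabulate; allFin)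
open import Data.Nat.Base as ℕ using (ℕ; zero; suc; NonZero)
open import Data.Nat.Coprimality using (Coprime)
import Data.Nat.Coprimality as Coprime
open import Data.Nat.Divisibility using (_∣_; _∣?_)
open import Data.Nat.GCD using (gcd)
import Data.Nat.Properties as ℕ
open import Data.Product.Base using (_×_; _,_; ∃-syntax)
open import Data.Vec.Base as Vec using (Vec; []; _∷_; lookup)
open import Data.Vec.Relation.Unary.All using (All; all?)
open import Function.Base using (_∘_; id)
open import Function.Bundles using (_⇔_; mk⇔; Equivalence)
open import Relation.Binary.PropositionalEquality
open import Relation.Nullary.Decidable using (Dec; yes; no; does; _×-dec_)

import Data.Integer.Properties as ℤ
import Algebra.Properties.Semiring.Sum ℤ.+-*-semiring as ℤΣ

open import Defs

module Counting where

  open import Algebra.Properties.Semiring.Sum ℕ.+-*-semiring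
    using (sum-syntax; sum-cong-≗; sum-replicate-zero; *-distribˡ-sum; *-distribʳ-sum; ∑-comm; sum-permute)
  open import Data.Bool.Base using (true; false; if_then_else_)
  open import Data.Fin.Base using (_↑ˡ_; _↑ʳ_)
  open import Data.Fin.Properties using (toℕ-↑ˡ; toℕ-↑ʳ; toℕ<n)
  open import Data.List.Base using (_++_; concatMap)
  open import Data.List.Properties using (filter-++; length-++)
  open import Data.Nat.Base using (_+_; _*_; _^_; _/_; s<s; ≢-nonZero; ≢-nonZero⁻¹)
  open import Data.Nat.Coprimality using (coprime-/gcd; coprime-divisor)
  open import Data.Nat.Divisibility
    using (_∣0; >⇒∤; ∣m+n∣m⇒∣n; ∣m∣n⇒∣m+n; ∣-refl; ∣-trans; *-monoʳ-∣; *-monoˡ-∣; *-cancelˡ-∣)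
  open import Data.Nat.DivMod using (m*[n/m]≡n)
  open import Data.Nat.GCD using (gcd[m,n]∣m; gcd[m,n]∣n; gcd[m,n]≢0; n/gcd[m,n]≢0)
  open import Data.Nat.Properties using (+-assoc; *-assoc; +-identityʳ)
  open import Data.Sum.Base using (inj₂)
  open import Level using (Level)
  open import Relation.Nullary.Negation using (¬_; contradiction)
  open import Relation.Unary using (Pred; Decidable)

  private variable
    a p q : Level
    A C : Set a
    P : Set p
    Q : Set q

  𝟙 : Dec P → ℕ
  𝟙 P? = if does P? then 1 else 0

  𝟙-yes : (P? : Dec P) → P → 𝟙 P? ≡ 1
  𝟙-yes (yes _) _ = refl
  𝟙-yes (no ¬p) p = contradiction p ¬p

  𝟙-no : (P? : Dec P) → ¬ P → 𝟙 P? ≡ 0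
  𝟙-no (yes p) ¬p = contradiction p ¬p
  𝟙-no (no _)  _  = refl

  𝟙-⇔ : (P? : Dec P) (Q? : Dec Q) → P ⇔ Q → 𝟙 P? ≡ 𝟙 Q?
  𝟙-⇔ (yes _) (yes _) _   = refl
  𝟙-⇔ (no _)  (no _)  _   = refl
  𝟙-⇔ (yes p) (no ¬q) P⇔Q = contradiction (Equivalence.to P⇔Q p) ¬q
  𝟙-⇔ (no ¬p) (yes q) P⇔Q = contradiction (Equivalence.from P⇔Q q) ¬p

  𝟙-× : (P? : Dec P) (Q? : Dec Q) → 𝟙 (P? ×-dec Q?) ≡ 𝟙 P? * 𝟙 Q?
  𝟙-× (yes _) Q? = sym (+-identityʳ (𝟙 Q?))
  𝟙-× (no _)  Q? = refl

  length-filter-++ : {P : Pred A p} (P? : Decidable P) (xs ys : List A) →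
    length (filter P? (xs ++ ys)) ≡ length (filter P? xs) + length (filter P? ys)
  length-filter-++ P? xs ys = trans (cong length (filter-++ P? xs ys)) (length-++ (filter P? xs))

  length-filter-map : {P : Pred C p} (P? : Decidable P) (f : A → C) (xs : List A) →
    length (filter P? (map f xs)) ≡ length (filter (P? ∘ f) xs)
  length-filter-map P? f []       = refl
  length-filter-map P? f (x ∷ xs) with does (P? (f x))
  ... | true  = cong suc (length-filter-map P? f xs)
  ... | false = length-filter-map P? f xs

  length-filter-concatMap-tabulate : ∀ {n} {P : Pred C p} (P? : Decidable P) (g : Fin n → A) (f : A → List C) →
    length (filter P? (concatMap f (tabulate g))) ≡ ∑[ u < n ] length (filter P? (f (g u)))
  length-filter-concatMap-tabulate {n = zero}  P? g f = refl
  length-filter-concatMap-tabulate {n = suc n} P? g f =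
    trans (length-filter-++ P? (f (g zero)) _)
          (cong (length (filter P? (f (g zero))) +_) (length-filter-concatMap-tabulate P? (g ∘ suc) f))

  ∑ᵛ : ∀ {n} l → (Vec (Fin n) l → ℕ) → ℕ
  ∑ᵛ     zero    f = f []
  ∑ᵛ {n} (suc l) f = ∑[ u < n ] ∑ᵛ l (λ v → f (u ∷ v))

  length-filter-allVecs : ∀ {n} l {P : Pred (Vec (Fin n) l) p} (P? : Decidable P) →
    length (filter P? (allVecs n l)) ≡ ∑ᵛ l (λ v → 𝟙 (P? v))
  length-filter-allVecs zero P? with does (P? [])
  ... | true  = refl
  ... | false = refl
  length-filter-allVecs {n = n} (suc l) P? = begin
    length (filter P? (allVecs n (suc l)))
      ≡⟨ length-filter-concatMap-tabulate P? id (λ u → map (u ∷_) (allVecs n l)) ⟩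
    ∑[ u < n ] length (filter P? (map (u ∷_) (allVecs n l)))
      ≡⟨ sum-cong-≗ {n} (λ u → length-filter-map P? (u ∷_) (allVecs n l)) ⟩
    ∑[ u < n ] length (filter (P? ∘ (u ∷_)) (allVecs n l))
      ≡⟨ sum-cong-≗ {n} (λ u → length-filter-allVecs l (P? ∘ (u ∷_))) ⟩
    ∑ᵛ (suc l) (λ v → 𝟙 (P? v)) ∎
    where open ≡-Reasoning

  module _ {n : ℕ} where

    ∑ᵛ-cong : ∀ l {f g : Vec (Fin n) l → ℕ} → (∀ v → f v ≡ g v) → ∑ᵛ l f ≡ ∑ᵛ l g
    ∑ᵛ-cong zero    f≗g = f≗g []
    ∑ᵛ-cong (suc l) f≗g = sum-cong-≗ {n} (λ u → ∑ᵛ-cong l (λ v → f≗g (u ∷ v)))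

    *-distribˡ-∑ᵛ : ∀ l k (f : Vec (Fin n) l → ℕ) → k * ∑ᵛ l f ≡ ∑ᵛ l (λ v → k * f v)
    *-distribˡ-∑ᵛ zero    k f = refl
    *-distribˡ-∑ᵛ (suc l) k f = trans (*-distribˡ-sum k (λ u → ∑ᵛ l (λ v → f (u ∷ v))))
                                      (sum-cong-≗ {n} (λ u → *-distribˡ-∑ᵛ l k (λ v → f (u ∷ v))))

    ∑-∑ᵛ-comm : ∀ l (f : Fin n → Vec (Fin n) l → ℕ) →
      ∑[ u < n ] ∑ᵛ l (f u) ≡ ∑ᵛ l (λ v → ∑[ u < n ] f u v)
    ∑-∑ᵛ-comm zero    f = refl
    ∑-∑ᵛ-comm (suc l) f = trans (∑-comm (λ u w → ∑ᵛ l (λ v → f u (w ∷ v))))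
                                (sum-cong-≗ {n} (λ w → ∑-∑ᵛ-comm l (λ u v → f u (w ∷ v))))

    ∑ᵛ-permute : ∀ l (π : Permutation n n) (f : Vec (Fin n) l → ℕ) →
      ∑ᵛ l (λ v → f (Vec.map (π ⟨$⟩ʳ_) v)) ≡ ∑ᵛ l f
    ∑ᵛ-permute zero    π f = refl
    ∑ᵛ-permute (suc l) π f = trans (sum-cong-≗ {n} (λ u → ∑ᵛ-permute l π (λ v → f ((π ⟨$⟩ʳ u) ∷ v))))
                                   (sym (sum-permute (λ u → ∑ᵛ l (λ v → f (u ∷ v))) π))

    ∑ᵛ-all : ∀ l {P : Pred (Fin n) p} (P? : Decidable P) →
      ∑ᵛ l (λ v → 𝟙 (all? P? v)) ≡ (∑[ u < n ] 𝟙 (P? u)) ^ l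
    ∑ᵛ-all zero    P? = refl
    ∑ᵛ-all (suc l) P? = begin
      ∑[ u < n ] ∑ᵛ l (λ v → 𝟙 (P? u ×-dec all? P? v))
        ≡⟨ sum-cong-≗ {n} (λ u → ∑ᵛ-cong l (λ v → 𝟙-× (P? u) (all? P? v))) ⟩
      ∑[ u < n ] ∑ᵛ l (λ v → 𝟙 (P? u) * 𝟙 (all? P? v))
        ≡⟨ sum-cong-≗ {n} (λ u → *-distribˡ-∑ᵛ l (𝟙 (P? u)) (λ v → 𝟙 (all? P? v))) ⟨
      ∑[ u < n ] (𝟙 (P? u) * #all)
        ≡⟨ *-distribʳ-sum #all (λ u → 𝟙 (P? u)) ⟨
      (∑[ u < n ] 𝟙 (P? u)) * #all
        ≡⟨ cong ((∑[ u < n ] 𝟙 (P? u)) *_) (∑ᵛ-all l P?) ⟩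
      (∑[ u < n ] 𝟙 (P? u)) ^ suc l ∎
      where
      open ≡-Reasoning
      #all : ℕ
      #all = ∑ᵛ l (λ v → 𝟙 (all? P? v))

  ∑-splitAt : ∀ m {n} (f : Fin (m + n) → ℕ) →
    ∑[ i < m + n ] f i ≡ ∑[ i < m ] f (i ↑ˡ n) + ∑[ j < n ] f (m ↑ʳ j)
  ∑-splitAt zero    f = refl
  ∑-splitAt (suc m) f = trans (cong (f zero +_) (∑-splitAt m (f ∘ suc))) (sym (+-assoc (f zero) _ _))

  ∑-𝟙-∣-period : ∀ k → ∑[ i < suc k ] 𝟙 (suc k ∣? toℕ i) ≡ 1
  ∑-𝟙-∣-period k = cong₂ _+_ (𝟙-yes (suc k ∣? 0) (suc k ∣0))
    (trans (sum-cong-≗ {k} (λ i → 𝟙-no (suc k ∣? suc (toℕ i)) (>⇒∤ (s<s (toℕ<n i)))))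
           (sum-replicate-zero k))

  ∑-𝟙-∣-periods : ∀ g k .{{_ : NonZero k}} → ∑[ u < g * k ] 𝟙 (k ∣? toℕ u) ≡ g
  ∑-𝟙-∣-periods zero    k          = refl
  ∑-𝟙-∣-periods (suc g) k@(suc k′) = begin
    ∑[ u < k + g * k ] 𝟙 (k ∣? toℕ u)
      ≡⟨ ∑-splitAt k (λ u → 𝟙 (k ∣? toℕ u)) ⟩
    ∑[ i < k ] 𝟙 (k ∣? toℕ (i ↑ˡ g * k)) + ∑[ j < g * k ] 𝟙 (k ∣? toℕ (k ↑ʳ j))
      ≡⟨ cong₂ _+_ (sum-cong-≗ {k} (λ i → cong (λ x → 𝟙 (k ∣? x)) (toℕ-↑ˡ i (g * k))))
                   (sum-cong-≗ {g * k} (λ j → cong (λ x → 𝟙 (k ∣? x)) (toℕ-↑ʳ k j))) ⟩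
    ∑[ i < k ] 𝟙 (k ∣? toℕ i) + ∑[ j < g * k ] 𝟙 (k ∣? k + toℕ j)
      ≡⟨ cong₂ _+_ (∑-𝟙-∣-period k′)
                   (sum-cong-≗ {g * k} (λ j → 𝟙-⇔ (k ∣? k + toℕ j) (k ∣? toℕ j) k∣k+x⇔k∣x)) ⟩
    1 + ∑[ j < g * k ] 𝟙 (k ∣? toℕ j)
      ≡⟨ cong suc (∑-𝟙-∣-periods g k) ⟩
    suc g ∎
    where
    open ≡-Reasoning
    k∣k+x⇔k∣x : ∀ {x} → (k ∣ k + x) ⇔ (k ∣ x)
    k∣k+x⇔k∣x = mk⇔ (λ k∣k+x → ∣m+n∣m⇒∣n k∣k+x ∣-refl) (∣m∣n⇒∣m+n ∣-refl)

  module _ (A n : ℕ) .{{_ : NonZero n}} where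

    private
      g : ℕ
      g = gcd A n
      instance
        g≢0 : NonZero g
        g≢0 = ≢-nonZero (gcd[m,n]≢0 A n (inj₂ (≢-nonZero⁻¹ n)))
        n/g≢0 : NonZero (n / g)
        n/g≢0 = ≢-nonZero (n/gcd[m,n]≢0 A n)

      g*[n/g]≡n : g * (n / g) ≡ n
      g*[n/g]≡n = m*[n/m]≡n (gcd[m,n]∣n A n)

    ∣*⇔/gcd∣ : ∀ {u} → (n ∣ A * u) ⇔ (n / g ∣ u)
    ∣*⇔/gcd∣ {u} = mk⇔ to from
      where
      A*u≡g*[A/g*u] : A * u ≡ g * (A / g * u)
      A*u≡g*[A/g*u] = trans (cong (_* u) (sym (m*[n/m]≡n (gcd[m,n]∣m A n)))) (*-assoc g (A / g) u)
      to : n ∣ A * u → n / g ∣ u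
      to n∣Au = coprime-divisor (Coprime.sym (coprime-/gcd A n))
                  (*-cancelˡ-∣ g (subst₂ _∣_ (sym g*[n/g]≡n) A*u≡g*[A/g*u] n∣Au))
      from : n / g ∣ u → n ∣ A * u
      from n/g∣u = subst (_∣ A * u) g*[n/g]≡n (∣-trans (*-monoʳ-∣ g n/g∣u) (*-monoˡ-∣ u (gcd[m,n]∣m A n)))

    ∑-𝟙-∣*≡gcd : ∑[ u < n ] 𝟙 (n ∣? A * toℕ u) ≡ g
    ∑-𝟙-∣*≡gcd = trans (sum-cong-≗ {n} (λ u → 𝟙-⇔ (n ∣? A * toℕ u) (n / g ∣? toℕ u) ∣*⇔/gcd∣))
                       (subst (λ N → ∑[ u < N ] 𝟙 (n / g ∣? toℕ u) ≡ g) g*[n/g]≡n (∑-𝟙-∣-periods g (n / g)))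

open Counting

module MatrixSums where

  open import Data.Integer.Base using (+_; _+_; _-_; _*_)
  open import Data.Integer.Tactic.RingSolver using (solve-∀)
  open import Data.List.Base using (foldr)
  open import Data.List.Properties using (map-tabulate)
  open ℤΣ using (sum; ∑-distrib-+; *-distribˡ-sum)

  Σℤ≡sum : ∀ {r} (f : Fin r → ℤ) → Σℤ f ≡ sum f
  Σℤ≡sum f = trans (cong (foldr _+_ (+ 0)) (map-tabulate id f)) (foldr-tabulate f)
    where
    foldr-tabulate : ∀ {r} (h : Fin r → ℤ) → foldr _+_ (+ 0) (tabulate h) ≡ sum h
    foldr-tabulate {zero}  h = refl
    foldr-tabulate {suc r} h = cong (_+_ (h zero)) (foldr-tabulate (h ∘ suc))

  sum-const : ∀ r x → sum {r} (λ _ → x) ≡ + r * x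
  sum-const zero    x = sym (ℤ.*-zeroˡ x)
  sum-const (suc r) x = trans (cong (_+_ x) (sum-const r x)) (e x (+ r))
    where
    e : ∀ x r → x + r * x ≡ (+ 1 + r) * x
    e = solve-∀

  -- The recursion on i uses that B c d (suc i) (suc j) computes to B c d i j.
  B-mul : ∀ c d {r} (i : Fin r) (X : Fin r → ℤ) → sum (λ j → B c d i j * X j) ≡ (c - d) * X i + d * sum X
  B-mul c d zero    X = trans (cong (_+_ (c * X zero)) (sym (*-distribˡ-sum d (X ∘ suc)))) (e c d (X zero) _)
    where
    e : ∀ c d x s → c * x + d * s ≡ (c - d) * x + d * (x + s)
    e = solve-∀
  B-mul c d (suc i) X = trans (cong (_+_ (d * X zero)) (B-mul c d i (X ∘ suc))) (e c d (X zero) (X (suc i)) _)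
    where
    e : ∀ c d x y s → d * x + ((c - d) * y + d * s) ≡ (c - d) * y + d * (x + s)
    e = solve-∀

  sum-B-mul : ∀ c d m (X : Fin (suc m) → ℤ) → sum (λ i → (c - d) * X i + d * sum X) ≡ (c + + m * d) * sum X
  sum-B-mul c d m X = begin
    sum (λ i → (c - d) * X i + d * sum X)
      ≡⟨ ∑-distrib-+ {suc m} (λ i → (c - d) * X i) (λ _ → d * sum X) ⟩
    sum (λ i → (c - d) * X i) + sum {suc m} (λ _ → d * sum X)
      ≡⟨ cong₂ _+_ (sym (*-distribˡ-sum (c - d) X)) (sum-const (suc m) (d * sum X)) ⟩
    (c - d) * sum X + + suc m * (d * sum X)
      ≡⟨ e c d (+ m) (sum X) ⟩
    (c + + m * d) * sum X ∎
    where
    open ≡-Reasoning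
    e : ∀ c d m s → (c - d) * s + (+ 1 + m) * (d * s) ≡ (c + m * d) * s
    e = solve-∀

open MatrixSums

module Congruence (n : ℕ) where

  open import Data.Fin.Base using (fromℕ<)
  open import Data.Fin.Permutation using (permutation)
  open import Data.Fin.Properties using (toℕ-fromℕ<; toℕ-injective; toℕ<n)
  open import Data.Integer.Base using (+_; -_; _+_; _-_; _*_; ∣_∣)
  open import Data.Integer.Divisibility.Signed as ℤ∣ using (divides; ∣-refl; ∣m⇒∣-m; ∣n⇒∣m*n)
  open import Data.Integer.Tactic.RingSolver using (solve-∀)
  open import Data.Nat.Coprimality using (coprime-Bézout; coprime-divisor)
  open import Data.Nat.GCD using (module Bézout)
  open import Relation.Binary.Bundles using (Setoid)
  import Relation.Binary.Reasoning.Setoid as SetoidReasoning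

  infix 4 _≈_
  record _≈_ (x y : ℤ) : Set where
    constructor mod
    field ∣difference : + n ℤ∣.∣ x - y

  ≈-via : ∀ {x y z} → x - y ≡ z → + n ℤ∣.∣ z → x ≈ y
  ≈-via x-y≡z n∣z = mod (subst (+ n ℤ∣.∣_) (sym x-y≡z) n∣z)

  ≈-refl : ∀ {x} → x ≈ x
  ≈-refl {x} = ≈-via (ℤ.+-inverseʳ x) (divides (+ 0) refl)

  ≈-reflexive : ∀ {x y} → x ≡ y → x ≈ y
  ≈-reflexive refl = ≈-refl

  ≈-sym : ∀ {x y} → x ≈ y → y ≈ x
  ≈-sym {x} {y} (mod p) = ≈-via (e x y) (∣m⇒∣-m p)
    where
    e : ∀ x y → y - x ≡ - (x - y)
    e = solve-∀

  ≈-trans : ∀ {x y z} → x ≈ y → y ≈ z → x ≈ z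
  ≈-trans {x} {y} {z} (mod p) (mod q) = ≈-via (e x y z) (ℤ∣.∣m∣n⇒∣m+n p q)
    where
    e : ∀ x y z → x - z ≡ (x - y) + (y - z)
    e = solve-∀

  ≈-setoid : Setoid _ _
  ≈-setoid = record { _≈_ = _≈_ ; isEquivalence = record { refl = ≈-refl ; sym = ≈-sym ; trans = ≈-trans } }

  +-cong : ∀ {x y u v} → x ≈ y → u ≈ v → x + u ≈ y + v
  +-cong {x} {y} {u} {v} (mod p) (mod q) = ≈-via (e x y u v) (ℤ∣.∣m∣n⇒∣m+n p q)
    where
    e : ∀ x y u v → (x + u) - (y + v) ≡ (x - y) + (u - v)
    e = solve-∀

  -‿cong : ∀ {x y u v} → x ≈ y → u ≈ v → x - u ≈ y - v
  -‿cong {x} {y} {u} {v} (mod p) (mod q) = ≈-via (e x y u v) (ℤ∣.∣m∣n⇒∣m-n p q)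
    where
    e : ∀ x y u v → (x - u) - (y - v) ≡ (x - y) - (u - v)
    e = solve-∀

  *-cong : ∀ {x y u v} → x ≈ y → u ≈ v → x * u ≈ y * v
  *-cong {x} {y} {u} {v} (mod p) (mod q) = ≈-via (e x y u v) (ℤ∣.∣m∣n⇒∣m+n (∣n⇒∣m*n x q) (ℤ∣.∣m⇒∣m*n v p))
    where
    e : ∀ x y u v → x * u - y * v ≡ x * (u - v) + (x - y) * v
    e = solve-∀

  ≈0⇔∣ : ∀ {z} → (z ≈ + 0) ⇔ (n ∣ ∣ z ∣)
  ≈0⇔∣ {z} = mk⇔ (λ (mod p) → ℤ∣.∣⇒∣ᵤ (subst (+ n ℤ∣.∣_) (ℤ.+-identityʳ z) p))
                 (λ p → ≈-via (ℤ.+-identityʳ z) (ℤ∣.∣ᵤ⇒∣ p))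

  ∣-cong : ∀ {x y} → x ≈ y → (n ∣ ∣ x ∣) ⇔ (n ∣ ∣ y ∣)
  ∣-cong x≈y = mk⇔ (transport x≈y) (transport (≈-sym x≈y))
    where
    transport : ∀ {x y} → x ≈ y → n ∣ ∣ x ∣ → n ∣ ∣ y ∣
    transport x≈y n∣x = Equivalence.to ≈0⇔∣ (≈-trans (≈-sym x≈y) (Equivalence.from ≈0⇔∣ n∣x))

  sum-cong-≈ : ∀ {r} {f g : Fin r → ℤ} → (∀ i → f i ≈ g i) → ℤΣ.sum f ≈ ℤΣ.sum g
  sum-cong-≈ {zero}  f≈g = ≈-refl
  sum-cong-≈ {suc r} f≈g = +-cong (f≈g zero) (sum-cong-≈ (f≈g ∘ suc))

  sum-≈0 : ∀ {r} {f : Fin r → ℤ} → (∀ i → f i ≈ + 0) → ℤΣ.sum f ≈ + 0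
  sum-≈0 {r} f≈0 = ≈-trans (sum-cong-≈ f≈0) (≈-reflexive (ℤΣ.sum-replicate-zero r))

  private
    pos-+* : ∀ a b c d e → a ℕ.+ b ℕ.* c ≡ d ℕ.* e → + a + + b * + c ≡ + d * + e
    pos-+* a b c d e eq = trans (cong (_+_ (+ a)) (sym (ℤ.pos-* b c))) (trans (cong +_ eq) (ℤ.pos-* d e))

  Invertible : ℤ → Set
  Invertible R = ∃[ R′ ] R * R′ ≈ + 1

  invertible : ∀ {r} → Coprime r n → Invertible (+ r)
  invertible {r} cop with coprime-Bézout cop
  ... | Bézout.+- x y 1+yn≡xr = + x , ≈-via (begin
          + r * + x - + 1         ≡⟨ e₁ (+ r) (+ x) ⟩
          + x * + r - + 1         ≡⟨ cong (_- + 1) (sym (pos-+* 1 y n x r 1+yn≡xr)) ⟩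
          + 1 + + y * + n - + 1   ≡⟨ e₂ (+ y * + n) ⟩
          + y * + n               ∎) (∣n⇒∣m*n (+ y) ∣-refl)
    where
    open ≡-Reasoning
    e₁ : ∀ r x → r * x - + 1 ≡ x * r - + 1
    e₁ = solve-∀
    e₂ : ∀ k → + 1 + k - + 1 ≡ k
    e₂ = solve-∀
  ... | Bézout.-+ x y 1+xr≡yn = - + x , ≈-via (begin
          + r * - + x - + 1       ≡⟨ e (+ r) (+ x) ⟩
          - (+ 1 + + x * + r)     ≡⟨ cong -_ (pos-+* 1 x r y n 1+xr≡yn) ⟩
          - (+ y * + n)           ∎) (∣m⇒∣-m (∣n⇒∣m*n (+ y) ∣-refl))
    where
    open ≡-Reasoning
    e : ∀ r x → r * - x - + 1 ≡ - (+ 1 + x * r)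
    e = solve-∀

  *-cancelˡ-≈0 : ∀ {r z} → Coprime r n → + r * z ≈ + 0 → z ≈ + 0
  *-cancelˡ-≈0 {r} {z} cop rz≈0 = Equivalence.from ≈0⇔∣
    (coprime-divisor (Coprime.sym cop) (subst (n ∣_) (ℤ.abs-* (+ r) z) (Equivalence.to ≈0⇔∣ rz≈0)))

  module Residues .{{_ : NonZero n}} where

    open import Algebra.Properties.Semiring.Sum ℕ.+-*-semiring using (sum-syntax; sum-cong-≗; sum-permute)
    open import Data.Integer.DivMod using (_%ℕ_; _/ℕ_; n%ℕd<d; a≡a%ℕn+[a/ℕn]*n)
    open import Data.Nat.DivMod using (m<n⇒m%n≡m)
    open import Data.Nat.Divisibility using (n∣m⇒m%n≡0)

    ⟦_⟧ : Fin n → ℤ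
    ⟦ u ⟧ = + toℕ u

    reduce : ℤ → Fin n
    reduce z = fromℕ< (n%ℕd<d z n)

    ⟦reduce⟧≈ : ∀ z → ⟦ reduce z ⟧ ≈ z
    ⟦reduce⟧≈ z = ≈-via (begin
        ⟦ reduce z ⟧ - z                       ≡⟨ cong₂ _-_ (cong +_ (toℕ-fromℕ< (n%ℕd<d z n))) (a≡a%ℕn+[a/ℕn]*n z n) ⟩
        + (z %ℕ n) - (+ (z %ℕ n) + q * + n)   ≡⟨ e (+ (z %ℕ n)) q (+ n) ⟩
        - q * + n                              ∎)
      (∣n⇒∣m*n (- q) ∣-refl)
      where
      open ≡-Reasoning
      q : ℤ
      q = z /ℕ n
      e : ∀ r q n → r - (r + q * n) ≡ - q * n
      e = solve-∀

    ⟦⟧-injective : ∀ {u v} → ⟦ u ⟧ ≈ ⟦ v ⟧ → u ≡ v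
    ⟦⟧-injective {u} {v} (mod n∣u-v) =
      toℕ-injective (ℤ.+-injective (ℤ.i-j≡0⇒i≡j ⟦ u ⟧ ⟦ v ⟧ (ℤ.∣i∣≡0⇒i≡0 ∣u-v∣≡0)))
      where
      ∣u-v∣<n : ∣ ⟦ u ⟧ - ⟦ v ⟧ ∣ ℕ.< n
      ∣u-v∣<n = subst (ℕ._< n) (cong ∣_∣ (sym (ℤ.m-n≡m⊖n (toℕ u) (toℕ v))))
                  (ℕ.≤-<-trans (ℤ.∣m⊝n∣≤m⊔n (toℕ u) (toℕ v)) (ℕ.⊔-pres-<m (toℕ<n u) (toℕ<n v)))
      ∣u-v∣≡0 : ∣ ⟦ u ⟧ - ⟦ v ⟧ ∣ ≡ 0
      ∣u-v∣≡0 = trans (sym (m<n⇒m%n≡m ∣u-v∣<n)) (n∣m⇒m%n≡0 _ n (ℤ∣.∣⇒∣ᵤ n∣u-v))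

    reduce-unique : ∀ {u z} → ⟦ u ⟧ ≈ z → reduce z ≡ u
    reduce-unique u≈z = ⟦⟧-injective (≈-trans (⟦reduce⟧≈ _) (≈-sym u≈z))

    affine : ∀ R → Invertible R → ℤ → Permutation n n
    affine R (R′ , RR′≈1) s = permutation (λ u → reduce (R * ⟦ u ⟧ + s)) (λ v → reduce (R′ * (⟦ v ⟧ - s)))
      (λ v → reduce-unique (≈-sym (begin
        R * ⟦ reduce (R′ * (⟦ v ⟧ - s)) ⟧ + s  ≈⟨ +-cong (*-cong (≈-refl {R}) (⟦reduce⟧≈ _)) (≈-refl {s}) ⟩
        R * (R′ * (⟦ v ⟧ - s)) + s             ≡⟨ e₁ R R′ ⟦ v ⟧ s ⟩
        R * R′ * (⟦ v ⟧ - s) + s               ≈⟨ +-cong (*-cong RR′≈1 (≈-refl {⟦ v ⟧ - s})) (≈-refl {s}) ⟩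
        + 1 * (⟦ v ⟧ - s) + s                  ≡⟨ e₂ ⟦ v ⟧ s ⟩
        ⟦ v ⟧                                  ∎)))
      (λ u → reduce-unique (≈-sym (begin
        R′ * (⟦ reduce (R * ⟦ u ⟧ + s) ⟧ - s)  ≈⟨ *-cong (≈-refl {R′}) (-‿cong (⟦reduce⟧≈ (R * ⟦ u ⟧ + s)) (≈-refl {s})) ⟩
        R′ * ((R * ⟦ u ⟧ + s) - s)             ≡⟨ e₃ R R′ ⟦ u ⟧ s ⟩
        R * R′ * ⟦ u ⟧                         ≈⟨ *-cong RR′≈1 (≈-refl {⟦ u ⟧}) ⟩
        + 1 * ⟦ u ⟧                            ≡⟨ ℤ.*-identityˡ ⟦ u ⟧ ⟩
        ⟦ u ⟧                                  ∎)))
      where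
      open SetoidReasoning ≈-setoid
      e₁ : ∀ R R′ v s → R * (R′ * (v - s)) + s ≡ R * R′ * (v - s) + s
      e₁ = solve-∀
      e₂ : ∀ v s → + 1 * (v - s) + s ≡ v
      e₂ = solve-∀
      e₃ : ∀ R R′ u s → R′ * ((R * u + s) - s) ≡ R * R′ * u
      e₃ = solve-∀

    ∑-𝟙-∣ℤ*≡gcd : ∀ β → ∑[ u < n ] 𝟙 (n ∣? ∣ β * ⟦ u ⟧ ∣) ≡ gcd ∣ β ∣ n
    ∑-𝟙-∣ℤ*≡gcd β =
      trans (sum-cong-≗ {n} (λ u → cong (λ k → 𝟙 (n ∣? k)) (ℤ.abs-* β ⟦ u ⟧))) (∑-𝟙-∣*≡gcd ∣ β ∣ n)

    ∑-𝟙-∣ℤ*-affine≡gcd : ∀ β R → Invertible R → ∀ s →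
      ∑[ u < n ] 𝟙 (n ∣? ∣ β * (R * ⟦ u ⟧ + s) ∣) ≡ gcd ∣ β ∣ n
    ∑-𝟙-∣ℤ*-affine≡gcd β R R-invertible s = begin
      ∑[ u < n ] 𝟙 (n ∣? ∣ β * (R * ⟦ u ⟧ + s) ∣)
        ≡⟨ sum-cong-≗ {n} (λ u → 𝟙-⇔ (n ∣? ∣ β * (R * ⟦ u ⟧ + s) ∣) (n ∣? ∣ β * ⟦ π ⟨$⟩ʳ u ⟧ ∣)
                                       (∣-cong (*-cong (≈-refl {β}) (≈-sym (⟦reduce⟧≈ (R * ⟦ u ⟧ + s)))))) ⟩
      ∑[ u < n ] 𝟙 (n ∣? ∣ β * ⟦ π ⟨$⟩ʳ u ⟧ ∣)
        ≡⟨ sum-permute (λ v → 𝟙 (n ∣? ∣ β * ⟦ v ⟧ ∣)) π ⟨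
      ∑[ v < n ] 𝟙 (n ∣? ∣ β * ⟦ v ⟧ ∣)
        ≡⟨ ∑-𝟙-∣ℤ*≡gcd β ⟩
      gcd ∣ β ∣ n ∎
      where
      open ≡-Reasoning
      π : Permutation n n
      π = affine R R-invertible s

module Lattice (c d : ℤ) (n m : ℕ) .{{_ : NonZero n}} (cop : Coprime (suc m) n) where

  open import Algebra.Properties.Semiring.Sum ℕ.+-*-semiring using (sum-syntax; sum-cong-≗)
  open import Data.Integer.Base using (+_; _+_; _-_; _*_; ∣_∣)
  open import Data.Integer.Tactic.RingSolver using (solve-∀)
  import Data.List.Relation.Unary.All as List
  open import Data.List.Relation.Unary.All.Properties using (tabulate⁺; tabulate⁻)
  import Data.Product.Base as Product
  open import Data.Vec.Properties using (lookup-map)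
  open import Data.Vec.Relation.Unary.All.Properties using (lookup⁺; lookup⁻)
  import Relation.Binary.Reasoning.Setoid as SetoidReasoning
  open Congruence n
  open Residues

  a b R : ℤ
  a = c - d
  b = c + + m * d
  R = + suc m

  translation : Fin n → Permutation n n
  translation t = affine (+ 1) (+ 1 , ≈-refl) ⟦ t ⟧

  translate : Fin n → Vec (Fin n) m → Vec (Fin n) m
  translate t = Vec.map (translation t ⟨$⟩ʳ_)

  Σ⟦_⟧ : Vec (Fin n) m → ℤ
  Σ⟦ z ⟧ = ℤΣ.sum (λ j → ⟦ lookup z j ⟧)

  module _ (t : Fin n) (z : Vec (Fin n) m) where

    open SetoidReasoning ≈-setoid

    private
      X : Fin (suc m) → ℤ
      X i = ⟦ lookup (t ∷ translate t z) i ⟧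

      Z : Fin m → ℤ
      Z j = ⟦ lookup z j ⟧

      S : ℤ
      S = ℤΣ.sum X

      X-suc≈ : ∀ j → X (suc j) ≈ Z j + ⟦ t ⟧
      X-suc≈ j = begin
        X (suc j)                       ≡⟨ cong ⟦_⟧ (lookup-map j (translation t ⟨$⟩ʳ_) z) ⟩
        ⟦ reduce (+ 1 * Z j + ⟦ t ⟧) ⟧  ≈⟨ ⟦reduce⟧≈ (+ 1 * Z j + ⟦ t ⟧) ⟩
        + 1 * Z j + ⟦ t ⟧               ≡⟨ cong (_+ ⟦ t ⟧) (ℤ.*-identityˡ (Z j)) ⟩
        Z j + ⟦ t ⟧                     ∎

      S≈ : S ≈ R * ⟦ t ⟧ + Σ⟦ z ⟧
      S≈ = begin
        ⟦ t ⟧ + ℤΣ.sum (X ∘ suc)                     ≈⟨ +-cong (≈-refl {⟦ t ⟧}) (sum-cong-≈ X-suc≈) ⟩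
        ⟦ t ⟧ + ℤΣ.sum (λ j → Z j + ⟦ t ⟧)           ≡⟨ cong (_+_ ⟦ t ⟧) (ℤΣ.∑-distrib-+ Z (λ _ → ⟦ t ⟧)) ⟩
        ⟦ t ⟧ + (Σ⟦ z ⟧ + ℤΣ.sum {m} (λ _ → ⟦ t ⟧))  ≡⟨ cong (λ k → ⟦ t ⟧ + (Σ⟦ z ⟧ + k)) (sum-const m ⟦ t ⟧) ⟩
        ⟦ t ⟧ + (Σ⟦ z ⟧ + + m * ⟦ t ⟧)               ≡⟨ e ⟦ t ⟧ Σ⟦ z ⟧ (+ m) ⟩
        R * ⟦ t ⟧ + Σ⟦ z ⟧                           ∎
        where
        e : ∀ t s m → t + (s + m * t) ≡ (+ 1 + m) * t + s
        e = solve-∀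

      Bx≡ : ∀ i → Bx c d (t ∷ translate t z) i ≡ a * X i + d * S
      Bx≡ i = trans (Σℤ≡sum (λ j → B c d i j * X j)) (B-mul c d i X)

      rows≈0⇒conditions : (∀ i → a * X i + d * S ≈ + 0) → b * (R * ⟦ t ⟧ + Σ⟦ z ⟧) ≈ + 0 × (∀ j → a * Z j ≈ + 0)
      rows≈0⇒conditions rows≈0 = bS≈0 , aZ≈0
        where
        bS≈0 : b * (R * ⟦ t ⟧ + Σ⟦ z ⟧) ≈ + 0
        bS≈0 = begin
          b * (R * ⟦ t ⟧ + Σ⟦ z ⟧)         ≈⟨ *-cong (≈-refl {b}) (≈-sym S≈) ⟩
          b * S                             ≡⟨ sum-B-mul c d m X ⟨
          ℤΣ.sum (λ i → a * X i + d * S)    ≈⟨ sum-≈0 rows≈0 ⟩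
          + 0                               ∎
        aZ≈0 : ∀ j → a * Z j ≈ + 0
        aZ≈0 j = begin
          a * Z j                                            ≡⟨ e a (Z j) ⟦ t ⟧ (d * S) ⟩
          (a * (Z j + ⟦ t ⟧) + d * S) - (a * ⟦ t ⟧ + d * S)  ≈⟨ -‿cong (+-cong (*-cong (≈-refl {a}) (≈-sym (X-suc≈ j))) (≈-refl {d * S}))
                                                                      (≈-refl {a * ⟦ t ⟧ + d * S}) ⟩
          (a * X (suc j) + d * S) - (a * X zero + d * S)     ≈⟨ -‿cong (rows≈0 (suc j)) (rows≈0 zero) ⟩
          + 0                                                ∎
          where
          e : ∀ a z t w → a * z ≡ (a * (z + t) + w) - (a * t + w)
          e = solve-∀

      conditions⇒rows≈0 : b * (R * ⟦ t ⟧ + Σ⟦ z ⟧) ≈ + 0 → (∀ j → a * Z j ≈ + 0) → ∀ i → a * X i + d * S ≈ + 0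
      conditions⇒rows≈0 bS≈0 aZ≈0 i = ≈-trans (+-cong (aX≈at i) (≈-refl {d * S})) row₀≈0
        where
        aX≈at : ∀ i → a * X i ≈ a * ⟦ t ⟧
        aX≈at zero    = ≈-refl
        aX≈at (suc j) = begin
          a * X (suc j)        ≈⟨ *-cong (≈-refl {a}) (X-suc≈ j) ⟩
          a * (Z j + ⟦ t ⟧)    ≡⟨ ℤ.*-distribˡ-+ a (Z j) ⟦ t ⟧ ⟩
          a * Z j + a * ⟦ t ⟧  ≈⟨ +-cong (aZ≈0 j) (≈-refl {a * ⟦ t ⟧}) ⟩
          + 0 + a * ⟦ t ⟧      ≡⟨ ℤ.+-identityˡ (a * ⟦ t ⟧) ⟩
          a * ⟦ t ⟧            ∎
        aΣz≈0 : a * Σ⟦ z ⟧ ≈ + 0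
        aΣz≈0 = ≈-trans (≈-reflexive (ℤΣ.*-distribˡ-sum a Z)) (sum-≈0 aZ≈0)
        row₀≈0 : a * ⟦ t ⟧ + d * S ≈ + 0
        row₀≈0 = *-cancelˡ-≈0 cop (begin
          R * (a * ⟦ t ⟧ + d * S)                           ≡⟨ e₁ c d (+ m) ⟦ t ⟧ S ⟩
          b * S - a * (S - R * ⟦ t ⟧)                       ≈⟨ -‿cong (*-cong (≈-refl {b}) S≈) (*-cong (≈-refl {a}) (-‿cong S≈ (≈-refl {R * ⟦ t ⟧}))) ⟩
          b * (R * ⟦ t ⟧ + Σ⟦ z ⟧) - a * (R * ⟦ t ⟧ + Σ⟦ z ⟧ - R * ⟦ t ⟧)
                                                            ≡⟨ cong (λ k → b * (R * ⟦ t ⟧ + Σ⟦ z ⟧) - a * k) (e₂ (R * ⟦ t ⟧) Σ⟦ z ⟧) ⟩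
          b * (R * ⟦ t ⟧ + Σ⟦ z ⟧) - a * Σ⟦ z ⟧             ≈⟨ -‿cong bS≈0 aΣz≈0 ⟩
          + 0                                               ∎)
          where
          e₁ : ∀ c d m t s → (+ 1 + m) * ((c - d) * t + d * s) ≡ (c + m * d) * s - (c - d) * (s - (+ 1 + m) * t)
          e₁ = solve-∀
          e₂ : ∀ x y → x + y - x ≡ y
          e₂ = solve-∀

      InΛfin⇔rows≈0 : InΛfin c d n (suc m) (t ∷ translate t z) ⇔ (∀ i → a * X i + d * S ≈ + 0)
      InΛfin⇔rows≈0 = mk⇔
        (λ x∈Λ i → Equivalence.from ≈0⇔∣ (subst (λ e → n ∣ ∣ e ∣) (Bx≡ i) (tabulate⁻ {f = id} x∈Λ i)))
        (λ rows≈0 → tabulate⁺ {f = id} (λ i → subst (λ e → n ∣ ∣ e ∣) (sym (Bx≡ i)) (Equivalence.to ≈0⇔∣ (rows≈0 i))))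

    InΛfin-translate⇔ : InΛfin c d n (suc m) (t ∷ translate t z)
                        ⇔ (n ∣ ∣ b * (R * ⟦ t ⟧ + Σ⟦ z ⟧) ∣ × All (λ u → n ∣ ∣ a * ⟦ u ⟧ ∣) z)
    InΛfin-translate⇔ = mk⇔
      (λ x∈Λ → Product.map (Equivalence.to ≈0⇔∣) (λ aZ≈0 → lookup⁻ (λ j → Equivalence.to ≈0⇔∣ (aZ≈0 j)))
                 (rows≈0⇒conditions (Equivalence.to InΛfin⇔rows≈0 x∈Λ)))
      (λ (n∣bS , n∣aZ) → Equivalence.from InΛfin⇔rows≈0
                 (conditions⇒rows≈0 (Equivalence.from ≈0⇔∣ n∣bS) (λ j → Equivalence.from ≈0⇔∣ (lookup⁺ n∣aZ j))))

  bS≡0? : ∀ t z → Dec (n ∣ ∣ b * (R * ⟦ t ⟧ + Σ⟦ z ⟧) ∣)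
  bS≡0? t z = n ∣? ∣ b * (R * ⟦ t ⟧ + Σ⟦ z ⟧) ∣

  au≡0? : ∀ u → Dec (n ∣ ∣ a * ⟦ u ⟧ ∣)
  au≡0? u = n ∣? ∣ a * ⟦ u ⟧ ∣

  az≡0? : (z : Vec (Fin n) m) → Dec (All (λ u → n ∣ ∣ a * ⟦ u ⟧ ∣) z)
  az≡0? z = all? au≡0? z

  cardΛfin≡∑∑ᵛ : cardΛfin c d n (suc m) ≡ ∑[ t < n ] ∑ᵛ m (λ z → 𝟙 (bS≡0? t z) ℕ.* 𝟙 (az≡0? z))
  cardΛfin≡∑∑ᵛ = begin
    cardΛfin c d n (suc m)
      ≡⟨ length-filter-allVecs (suc m) Λ? ⟩
    ∑[ t < n ] ∑ᵛ m (λ y → 𝟙 (Λ? (t ∷ y)))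
      ≡⟨ sum-cong-≗ {n} (λ t → ∑ᵛ-permute m (translation t) (λ y → 𝟙 (Λ? (t ∷ y)))) ⟨
    ∑[ t < n ] ∑ᵛ m (λ z → 𝟙 (Λ? (t ∷ translate t z)))
      ≡⟨ sum-cong-≗ {n} (λ t → ∑ᵛ-cong m (λ z →
           trans (𝟙-⇔ (Λ? (t ∷ translate t z)) (bS≡0? t z ×-dec az≡0? z) (InΛfin-translate⇔ t z))
                 (𝟙-× (bS≡0? t z) (az≡0? z)))) ⟩
    ∑[ t < n ] ∑ᵛ m (λ z → 𝟙 (bS≡0? t z) ℕ.* 𝟙 (az≡0? z)) ∎
    where
    open ≡-Reasoning
    Λ? : ∀ x → Dec (InΛfin c d n (suc m) x)
    Λ? x = List.all? (λ i → n ∣? ∣ Bx c d x i ∣) (allFin (suc m))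

open import Algebra.Properties.Semiring.Sum ℕ.+-*-semiring using (sum-syntax; *-distribʳ-sum)
open import Data.Integer using (+_; ∣_∣; _-_; _+_)
open import Data.Nat.Base using (_≤_; _^_; _*_; _∸_)

corollary7p4 : (r n : ℕ) → 1 ≤ r → 1 ≤ n → Coprime r n → (c d : ℤ) →
    let d₁ = gcd ∣ c - d ∣ n
        d₂ = gcd ∣ c + (+ (r ∸ 1)) Data.Integer.* d ∣ n
    in cardΛfin c d n r ≡ d₁ ^ (r ∸ 1) * d₂
corollary7p4 (suc m) n@(suc _) _ _ cop c d = begin
  cardΛfin c d n (suc m)
    ≡⟨ cardΛfin≡∑∑ᵛ ⟩
  ∑[ t < n ] ∑ᵛ m (λ z → 𝟙 (bS≡0? t z) * 𝟙 (az≡0? z))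
    ≡⟨ ∑-∑ᵛ-comm m (λ t z → 𝟙 (bS≡0? t z) * 𝟙 (az≡0? z)) ⟩
  ∑ᵛ m (λ z → ∑[ t < n ] (𝟙 (bS≡0? t z) * 𝟙 (az≡0? z)))
    ≡⟨ ∑ᵛ-cong m (λ z → *-distribʳ-sum (𝟙 (az≡0? z)) (λ t → 𝟙 (bS≡0? t z))) ⟨
  ∑ᵛ m (λ z → (∑[ t < n ] 𝟙 (bS≡0? t z)) * 𝟙 (az≡0? z))
    ≡⟨ ∑ᵛ-cong m (λ z → cong (_* 𝟙 (az≡0? z)) (∑-𝟙-∣ℤ*-affine≡gcd b R (invertible cop) Σ⟦ z ⟧)) ⟩
  ∑ᵛ m (λ z → d₂ * 𝟙 (az≡0? z))
    ≡⟨ *-distribˡ-∑ᵛ m d₂ (𝟙 ∘ az≡0?) ⟨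
  d₂ * ∑ᵛ m (𝟙 ∘ az≡0?)
    ≡⟨ cong (d₂ *_) (trans (∑ᵛ-all m au≡0?) (cong (_^ m) (∑-𝟙-∣ℤ*≡gcd a))) ⟩
  d₂ * d₁ ^ m
    ≡⟨ ℕ.*-comm d₂ (d₁ ^ m) ⟩
  d₁ ^ m * d₂ ∎
  where
  open ≡-Reasoning
  open Lattice c d n m cop
  open Congruence n
  open Residues
  d₁ d₂ : ℕ
  d₁ = gcd ∣ a ∣ n
  d₂ = gcd ∣ b ∣ n
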